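{- Let $H$ be a bipartite graph whose two vertex classes each have size $n$, where $n$ is even. Let $\mathcal{M}=\{M_1,\ldots,M_m\}$ be a partition of the edge set of $H$ into perfect matchings. Then the graph $G[\mathcal{M}]$ is bipartite.
   Context: For a partition $\mathcal{M}=\{M_1,\ldots,M_m\}$ of the edges of a graph $H$ into perfect matchings (1-factors), $G[\mathcal{M}]$ denotes the graph with vertex set $\{M_1,\ldots,M_m\}$ in which $M_i$ and $M_j$ ($i\neq j$) are adjacent if and only if $M_i\cup M_j$ is a Hamilton cycle of $H$. -}

module Defs where

open import Data.Nat using (ℕ; zero; suc; _+_; _≤_)
import Data.Nat as ℕ
open import Data.Fin using (Fin; toℕ; lower₁) renaming (zero to fzero; suc to fsuc)
open import Data.Bool using (Bool; true; false; _∨_)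
open import Data.Sum using (_⊎_; inj₁; inj₂)
open import Data.Product using (Σ; ∃; ∃-syntax; _×_; _,_)
open import Relation.Binary.PropositionalEquality using (_≡_; _≢_)
open import Relation.Nullary using (yes; no)

-- A bipartite graph H with vertex classes L = Fin n and R = Fin n,
-- given by its edge set: E a b ≡ true iff {a ∈ L, b ∈ R} is an edge.
BipEdges : ℕ → Set
BipEdges n = Fin n → Fin n → Bool

-- vertex set of H: left class ⊎ right class
Vertex : ℕ → Set
Vertex n = Fin n ⊎ Fin n

adj : ∀ {n} → BipEdges n → Vertex n → Vertex n → Bool
adj F (inj₁ a) (inj₂ b) = F a b
adj F (inj₂ b) (inj₁ a) = F a b
adj F (inj₁ _) (inj₁ _) = false
adj F (inj₂ _) (inj₂ _) = false

_⊆ₑ_ : ∀ {n} → BipEdges n → BipEdges n → Set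
M ⊆ₑ E = ∀ a b → M a b ≡ true → E a b ≡ true

_∪ₑ_ : ∀ {n} → BipEdges n → BipEdges n → BipEdges n
(M ∪ₑ N) a b = M a b ∨ N a b

IsPerfectMatching : ∀ {n} → BipEdges n → BipEdges n → Set
IsPerfectMatching {n} E M =
  (M ⊆ₑ E)
  × (∀ (a : Fin n) → Σ (Fin n) λ b → M a b ≡ true × (∀ b' → M a b' ≡ true → b' ≡ b))
  × (∀ (b : Fin n) → Σ (Fin n) λ a → M a b ≡ true × (∀ a' → M a' b ≡ true → a' ≡ a))

-- M₁,…,Mₘ is a partition of the edge set of H into perfect matchings:
-- each block is a (nonempty) perfect matching of H and every edge of H
-- lies in exactly one block.
IsPerfectMatchingPartition : ∀ {n m} → BipEdges n → (Fin m → BipEdges n) → Set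
IsPerfectMatchingPartition {n} {m} E M =
  (∀ i → IsPerfectMatching E (M i))
  × (∀ i → Σ (Fin n) λ a → Σ (Fin n) λ b → M i a b ≡ true)
  × (∀ a b → E a b ≡ true →
       Σ (Fin m) λ i → M i a b ≡ true × (∀ j → M j a b ≡ true → j ≡ i))

next : ∀ {k} → Fin k → Fin k
next {suc k} i with toℕ i ℕ.≟ k
... | yes _ = fzero
... | no ne = fsuc (lower₁ i (λ eq → ne (Relation.Binary.PropositionalEquality.sym eq)))
  where import Relation.Binary.PropositionalEquality

-- F is (the edge set of) a Hamilton cycle of H: the 2n vertices of H can be
-- listed cyclically as v₀,…,v_{2n-1} (each vertex exactly once, 2n ≥ 3) so that
-- the edges of F are exactly the pairs {vᵢ, vᵢ₊₁} (indices mod 2n).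
IsHamiltonCycle : ∀ {n} → BipEdges n → Set
IsHamiltonCycle {n} F =
  (3 ≤ n + n) ×
  Σ (Fin (n + n) → Vertex n) λ v →
    (∀ i j → v i ≡ v j → i ≡ j)
    × (∀ x → ∃[ i ] v i ≡ x)
    × (∀ x y → adj F x y ≡ true →
          ∃[ i ] ((v i ≡ x × v (next i) ≡ y) ⊎ (v i ≡ y × v (next i) ≡ x)))
    × (∀ i → adj F (v i) (v (next i)) ≡ true)

-- adjacency of G[M]: Mᵢ ~ Mⱼ iff i ≠ j and Mᵢ ∪ Mⱼ is a Hamilton cycle of H
GAdj : ∀ {n m} → (Fin m → BipEdges n) → Fin m → Fin m → Set
GAdj M i j = (i ≢ j) × IsHamiltonCycle (M i ∪ₑ M j)

IsBipartite : ∀ {m} → (Fin m → Fin m → Set) → Set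
IsBipartite {m} R = Σ (Fin m → Bool) λ c → ∀ i j → R i j → c i ≢ c j

module Submission where

-- Colour each perfect matching M of H by the sign of the bijection
-- mate_M : L → R it induces between the two classes (both identified with
-- Fin n).  If M ∪ N is a Hamilton cycle, walking around it alternates
-- between edges of M and of N, so its n left vertices form a single orbit
-- a, τ a, …, τⁿ⁻¹ a of τ = mate_N⁻¹ ∘ mate_M.  Numbering this orbit by Fin n
-- gives a bijection α with mate_N ∘ α = mate_M ∘ α ∘ ρ, where ρ is an
-- n-cycle; as sign(ρ) = (-1)^(n-1) = -1 for even n, adjacent matchings get
-- different colours.

open import Defs
open import Data.Nat as ℕ using (ℕ; zero; suc; _+_)
import Data.Nat.Properties as ℕ
open import Data.Nat.Divisibility using (_∣_; divides)
open import Data.Fin using (Fin; toℕ; fromℕ; inject₁; punchOut)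
  renaming (zero to fzero; suc to fsuc)
open import Data.Fin.Properties using (_<?_; <-cmp; <-irrefl; any?; _≟_; toℕ-injective;
  toℕ-fromℕ; toℕ-inject₁; toℕ-lower₁; toℕ<n; punchOut-injective; injective⇒≤;
  inject₁-injective; fromℕ≢inject₁)
open import Data.Fin.Permutation using (Permutation′; _⟨$⟩ʳ_; permutation)
open import Data.Bool using (Bool; true; false; _∧_; _∨_; _xor_; not)
open import Data.Bool.Properties using (xor-∧-commutativeRing; ∧-distribˡ-xor; xor-identityʳ;
  xor-comm; xor-assoc; ∨-comm; not-¬; true-xor; not-involutive)
open import Algebra.Bundles using (CommutativeRing)
open import Data.Product using (Σ; _×_; _,_; proj₁; proj₂)
open import Data.Sum using (_⊎_; inj₁; inj₂)
open import Data.Sum.Properties using (inj₁-injective)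
open import Data.Empty using (⊥)
open import Function using (_∘_)
open import Function.Definitions using (Injective)
open import Relation.Binary using (tri<; tri≈; tri>)
open import Relation.Binary.PropositionalEquality
open import Relation.Nullary using (Dec; does; yes; no; contradiction)
open import Relation.Nullary.Decidable using (dec-true; dec-false)

-- Sums of Booleans are taken in the field 𝔽₂ = (Bool, xor, ∧).
module Xor = CommutativeRing xor-∧-commutativeRing
open import Algebra.Properties.CommutativeMonoid.Sum Xor.+-commutativeMonoid
  using (sum; ∑-distrib-+; ∑-comm; sum-permute; sum-cong-≗)
open import Algebra.Properties.Group Xor.+-group using (∙-cancelʳ)

private variable n : ℕ

_<ᵇ_ : Fin n → Fin n → Bool
x <ᵇ y = does (x <? y)

<ᵇ-irrefl : (x : Fin n) → x <ᵇ x ≡ false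
<ᵇ-irrefl x = dec-false (x <? x) (<-irrefl refl)

<ᵇ-flip : (x y : Fin n) → x ≢ y → y <ᵇ x ≡ not (x <ᵇ y)
<ᵇ-flip x y x≢y with <-cmp x y
... | tri< x<y _ y≮x = trans (dec-false (y <? x) y≮x) (cong not (sym (dec-true (x <? y) x<y)))
... | tri≈ _ x≡y _ = contradiction x≡y x≢y
... | tri> x≮y _ y<x = trans (dec-true (y <? x) y<x) (cong not (sym (dec-false (x <? y) x≮y)))

∑∑ : (Fin n → Fin n → Bool) → Bool
∑∑ a = sum (λ x → sum (a x))

∑∑-cong : {a b : Fin n → Fin n → Bool} → (∀ x y → a x y ≡ b x y) → ∑∑ a ≡ ∑∑ b
∑∑-cong a≗b = sum-cong-≗ (λ x → sum-cong-≗ (a≗b x))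

∑∑-xor : (a b : Fin n → Fin n → Bool) → ∑∑ (λ x y → a x y xor b x y) ≡ ∑∑ a xor ∑∑ b
∑∑-xor a b = trans (sum-cong-≗ (λ x → ∑-distrib-+ (a x) (b x)))
                   (∑-distrib-+ (λ x → sum (a x)) (λ x → sum (b x)))

sum-zero : (h : Fin n → Bool) → (∀ x → h x ≡ false) → sum h ≡ false
sum-zero {zero}  h h≡0 = refl
sum-zero {suc n} h h≡0 rewrite h≡0 fzero = sum-zero (h ∘ fsuc) (h≡0 ∘ fsuc)

∑∑-permute : (π : Permutation′ n) (a : Fin n → Fin n → Bool) →
             ∑∑ (λ x y → a (π ⟨$⟩ʳ x) (π ⟨$⟩ʳ y)) ≡ ∑∑ a
∑∑-permute π a = sym (trans (sum-permute (λ x → sum (a x)) π)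
                            (sum-cong-≗ (λ x → sum-permute (a (π ⟨$⟩ʳ x)) π)))

∑∑-symmetrise : (a : Fin n → Fin n → Bool) → (∀ x → a x x ≡ false) →
                ∑∑ (λ x y → x <ᵇ y ∧ (a x y xor a y x)) ≡ ∑∑ a
∑∑-symmetrise a diag = begin
  ∑∑ (λ x y → x <ᵇ y ∧ (a x y xor a y x))
    ≡⟨ ∑∑-cong (λ x y → ∧-distribˡ-xor (x <ᵇ y) (a x y) (a y x)) ⟩
  ∑∑ (λ x y → (x <ᵇ y ∧ a x y) xor (x <ᵇ y ∧ a y x))
    ≡⟨ ∑∑-xor (λ x y → x <ᵇ y ∧ a x y) (λ x y → x <ᵇ y ∧ a y x) ⟩
  ∑∑ (λ x y → x <ᵇ y ∧ a x y) xor ∑∑ (λ x y → x <ᵇ y ∧ a y x)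
    ≡⟨ cong (∑∑ (λ x y → x <ᵇ y ∧ a x y) xor_) (sym (∑-comm (λ x y → y <ᵇ x ∧ a x y))) ⟩
  ∑∑ (λ x y → x <ᵇ y ∧ a x y) xor ∑∑ (λ x y → y <ᵇ x ∧ a x y)
    ≡⟨ ∑∑-xor (λ x y → x <ᵇ y ∧ a x y) (λ x y → y <ᵇ x ∧ a x y) ⟨
  ∑∑ (λ x y → (x <ᵇ y ∧ a x y) xor (y <ᵇ x ∧ a x y))
    ≡⟨ ∑∑-cong split ⟩
  ∑∑ a ∎
  where
  open ≡-Reasoning
  split : ∀ x y → (x <ᵇ y ∧ a x y) xor (y <ᵇ x ∧ a x y) ≡ a x y
  split x y with x ≟ y
  ... | yes refl rewrite <ᵇ-irrefl x | diag x = refl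
  ... | no x≢y rewrite <ᵇ-flip x y x≢y with x <ᵇ y | a x y
  ... | false | false = refl
  ... | false | true  = refl
  ... | true  | false = refl
  ... | true  | true  = refl

injective⇒surjective : {f : Fin n → Fin n} → Injective _≡_ _≡_ f →
                       ∀ y → Σ (Fin n) λ x → f x ≡ y
injective⇒surjective {suc n} {f} f-inj y with any? (λ x → f x ≟ y)
... | yes hit = hit
... | no miss = contradiction (injective⇒≤ squeeze-inj) (ℕ.<-irrefl refl)
  where
  avoids : ∀ x → y ≢ f x
  avoids x y≡fx = miss (x , sym y≡fx)
  squeeze : Fin (suc n) → Fin n
  squeeze x = punchOut (avoids x)
  squeeze-inj : Injective _≡_ _≡_ squeeze
  squeeze-inj {a} {b} eq = f-inj (punchOut-injective (avoids a) (avoids b) eq)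

injective⇒permutation : (f : Fin n → Fin n) → Injective _≡_ _≡_ f → Permutation′ n
injective⇒permutation f f-inj = permutation f (proj₁ ∘ surj) (proj₂ ∘ surj)
                                            (λ x → f-inj (proj₂ (surj (f x))))
  where
  surj : ∀ y → Σ (Fin _) λ x → f x ≡ y
  surj = injective⇒surjective f-inj

-- Inversions of an endomap f and their parity (true = odd), i.e. the sign of f.
inversion : (Fin n → Fin n) → Fin n → Fin n → Bool
inversion f x y = x <ᵇ y ∧ f y <ᵇ f x

parity : (Fin n → Fin n) → Bool
parity f = ∑∑ (inversion f)

inversion-∘ : (f g : Fin n → Fin n) → Injective _≡_ _≡_ f → Injective _≡_ _≡_ g →
  ∀ x y → inversion (f ∘ g) x y
        ≡ inversion g x y xor (x <ᵇ y ∧ (inversion f (g x) (g y) xor inversion f (g y) (g x)))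
inversion-∘ f g f-inj g-inj x y with x <ᵇ y in x<y
... | false = refl
... | true = table (g y <ᵇ g x) (f (g y) <ᵇ f (g x))
                   (<ᵇ-flip (g y) (g x) (gx≢gy ∘ sym)) (<ᵇ-flip (f (g y)) (f (g x)) (fgx≢fgy ∘ sym))
  where
  x≢y : x ≢ y
  x≢y refl with () ← trans (sym x<y) (<ᵇ-irrefl x)
  gx≢gy : g x ≢ g y
  gx≢gy = x≢y ∘ g-inj
  fgx≢fgy : f (g x) ≢ f (g y)
  fgx≢fgy = gx≢gy ∘ f-inj
  table : ∀ q r {q′ r′} → q′ ≡ not q → r′ ≡ not r → r ≡ q xor ((q′ ∧ r) xor (q ∧ r′))
  table false false refl refl = refl
  table false true  refl refl = refl
  table true  false refl refl = refl
  table true  true  refl refl = refl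

parity-∘ : (f g : Fin n → Fin n) → Injective _≡_ _≡_ f → Injective _≡_ _≡_ g →
           parity (f ∘ g) ≡ parity f xor parity g
parity-∘ f g f-inj g-inj = begin
  parity (f ∘ g)
    ≡⟨ ∑∑-cong (inversion-∘ f g f-inj g-inj) ⟩
  ∑∑ (λ x y → inversion g x y xor (x <ᵇ y ∧ (inv-f-g x y xor inv-f-g y x)))
    ≡⟨ ∑∑-xor (inversion g) (λ x y → x <ᵇ y ∧ (inv-f-g x y xor inv-f-g y x)) ⟩
  parity g xor ∑∑ (λ x y → x <ᵇ y ∧ (inv-f-g x y xor inv-f-g y x))
    ≡⟨ cong (parity g xor_) (∑∑-symmetrise inv-f-g no-self-inversion) ⟩
  parity g xor ∑∑ inv-f-g
    ≡⟨ cong (parity g xor_) (∑∑-permute (injective⇒permutation g g-inj) (inversion f)) ⟩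
  parity g xor parity f
    ≡⟨ Xor.+-comm (parity g) (parity f) ⟩
  parity f xor parity g ∎
  where
  open ≡-Reasoning
  inv-f-g : Fin _ → Fin _ → Bool
  inv-f-g x y = inversion f (g x) (g y)
  no-self-inversion : ∀ x → inv-f-g x x ≡ false
  no-self-inversion x = cong (_∧ f (g x) <ᵇ f (g x)) (<ᵇ-irrefl (g x))

parity-cong : {f g : Fin n → Fin n} → (∀ x → f x ≡ g x) → parity f ≡ parity g
parity-cong f≗g = ∑∑-cong (λ x y → cong₂ (λ fy fx → x <ᵇ y ∧ fy <ᵇ fx) (f≗g y) (f≗g x))

odd : ℕ → Bool
odd zero    = false
odd (suc k) = not (odd k)

sum-true : ∀ k → sum {k} (λ _ → true) ≡ odd k
sum-true zero    = refl
sum-true (suc k) = cong not (sum-true k)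

does-∧ : ∀ {A : Set} (a? : Dec A) {c : Bool} → (A → c ≡ false) → does a? ∧ c ≡ false
does-∧ (yes a) c≡false = c≡false a
does-∧ (no _)  _       = refl

rot : ∀ {k} → Fin (suc k) → Fin (suc k)
rot fzero    = fromℕ _
rot (fsuc y) = inject₁ y

rot-injective : ∀ {k} → Injective _≡_ _≡_ (rot {k})
rot-injective {_} {fzero}  {fzero}  _  = refl
rot-injective {_} {fzero}  {fsuc y} eq = contradiction eq fromℕ≢inject₁
rot-injective {_} {fsuc x} {fzero}  eq = contradiction (sym eq) fromℕ≢inject₁
rot-injective {_} {fsuc x} {fsuc y} eq = cong fsuc (inject₁-injective eq)

-- The inversions of rot are exactly the pairs (0, y) with y > 0, so a cycle
-- of length suc k has sign (-1)^k.
parity-rot : ∀ k → parity (rot {k}) ≡ odd k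
parity-rot k = begin
  parity (rot {k})
    ≡⟨⟩
  (false xor sum (λ y → inversion ρ fzero (fsuc y))) xor sum (λ x → sum (inversion ρ (fsuc x)))
    ≡⟨ cong₂ (λ a b → (false xor a) xor b) (trans (sum-cong-≗ first-row) (sum-true k))
             (sum-zero {k} _ (λ x → sum-zero _ (later-row x))) ⟩
  odd k xor false
    ≡⟨ xor-identityʳ (odd k) ⟩
  odd k ∎
  where
  open ≡-Reasoning
  ρ : Fin (suc k) → Fin (suc k)
  ρ = rot
  first-row : ∀ y → inversion ρ fzero (fsuc y) ≡ true
  first-row y = cong₂ _∧_ (dec-true (fzero {k} <? fsuc y) ℕ.z<s)
    (dec-true (inject₁ y <? fromℕ k)
              (subst₂ ℕ._<_ (sym (toℕ-inject₁ y)) (sym (toℕ-fromℕ k)) (toℕ<n y)))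
  later-row : ∀ x y → inversion ρ (fsuc x) y ≡ false
  later-row x fzero = refl
  later-row x (fsuc y) = does-∧ (fsuc x <? fsuc y) λ { (ℕ.s<s x<y) →
    dec-false (inject₁ y <? inject₁ x)
              (λ y<x → ℕ.<-asym x<y (subst₂ ℕ._<_ (toℕ-inject₁ y) (toℕ-inject₁ x) y<x)) }

parity-conjugate-rot : ∀ {k} (σ τ α : Fin (suc k) → Fin (suc k)) →
  Injective _≡_ _≡_ σ → Injective _≡_ _≡_ τ → Injective _≡_ _≡_ α →
  (∀ y → σ (α y) ≡ τ (α (rot y))) → parity σ ≡ parity τ xor odd k
parity-conjugate-rot {k} σ τ α σ-inj τ-inj α-inj σα≡ταrot =
  ∙-cancelʳ (parity α) (parity σ) (parity τ xor odd k) (begin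
    parity σ xor parity α
      ≡⟨ parity-∘ σ α σ-inj α-inj ⟨
    parity (σ ∘ α)
      ≡⟨ parity-cong σα≡ταrot ⟩
    parity (τ ∘ (α ∘ rot))
      ≡⟨ parity-∘ τ (α ∘ rot) τ-inj (rot-injective ∘ α-inj) ⟩
    parity τ xor parity (α ∘ rot)
      ≡⟨ cong (parity τ xor_) (parity-∘ α rot α-inj rot-injective) ⟩
    parity τ xor (parity α xor parity (rot {k}))
      ≡⟨ cong (λ c → parity τ xor (parity α xor c)) (parity-rot k) ⟩
    parity τ xor (parity α xor odd k)
      ≡⟨ cong (parity τ xor_) (xor-comm (parity α) (odd k)) ⟩
    parity τ xor (odd k xor parity α)
      ≡⟨ xor-assoc (parity τ) (odd k) (parity α) ⟨
    (parity τ xor odd k) xor parity α ∎)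
  where open ≡-Reasoning

adj-sym : (F : BipEdges n) → ∀ x y → adj F x y ≡ adj F y x
adj-sym F (inj₁ a) (inj₁ b) = refl
adj-sym F (inj₁ a) (inj₂ b) = refl
adj-sym F (inj₂ b) (inj₁ a) = refl
adj-sym F (inj₂ a) (inj₂ b) = refl

adj-∪ : (P Q : BipEdges n) → ∀ x y → adj (P ∪ₑ Q) x y ≡ adj P x y ∨ adj Q x y
adj-∪ P Q (inj₁ a) (inj₁ b) = refl
adj-∪ P Q (inj₁ a) (inj₂ b) = refl
adj-∪ P Q (inj₂ b) (inj₁ a) = refl
adj-∪ P Q (inj₂ a) (inj₂ b) = refl

adj-∪-comm : (P Q : BipEdges n) → ∀ x y → adj (P ∪ₑ Q) x y ≡ adj (Q ∪ₑ P) x y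
adj-∪-comm P Q x y =
  trans (adj-∪ P Q x y) (trans (∨-comm (adj P x y) (adj Q x y)) (sym (adj-∪ Q P x y)))

adj-∪-split : (P Q : BipEdges n) → ∀ x y → adj (P ∪ₑ Q) x y ≡ true →
              adj P x y ≡ true ⊎ adj Q x y ≡ true
adj-∪-split P Q x y xy = ∨-split (trans (sym (adj-∪ P Q x y)) xy)
  where
  ∨-split : ∀ {a b} → a ∨ b ≡ true → a ≡ true ⊎ b ≡ true
  ∨-split {true}  _   = inj₁ refl
  ∨-split {false} b≡t = inj₂ b≡t

module Matching {E M : BipEdges n} (pm : IsPerfectMatching E M) where

  mate comate : Fin n → Fin n
  mate a   = proj₁ (proj₁ (proj₂ pm) a)
  comate b = proj₁ (proj₂ (proj₂ pm) b)

  mate-edge : ∀ a → M a (mate a) ≡ true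
  mate-edge a = proj₁ (proj₂ (proj₁ (proj₂ pm) a))

  comate-edge : ∀ b → M (comate b) b ≡ true
  comate-edge b = proj₁ (proj₂ (proj₂ (proj₂ pm) b))

  mate-unique : ∀ {a b} → M a b ≡ true → b ≡ mate a
  mate-unique {a} {b} = proj₂ (proj₂ (proj₁ (proj₂ pm) a)) b

  comate-unique : ∀ {a b} → M a b ≡ true → a ≡ comate b
  comate-unique {a} {b} = proj₂ (proj₂ (proj₂ (proj₂ pm) b)) a

  mate-comate : ∀ b → mate (comate b) ≡ b
  mate-comate b = sym (mate-unique (comate-edge b))

  mate-injective : Injective _≡_ _≡_ mate
  mate-injective {a} {a′} ma≡ma′ =
    trans (comate-unique (mate-edge a))
          (trans (cong comate ma≡ma′) (sym (comate-unique (mate-edge a′))))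

  partner : Vertex n → Vertex n
  partner (inj₁ a) = inj₂ (mate a)
  partner (inj₂ b) = inj₁ (comate b)

  adj⇒partner : ∀ x y → adj M x y ≡ true → y ≡ partner x
  adj⇒partner (inj₁ a) (inj₂ b) e = cong inj₂ (mate-unique e)
  adj⇒partner (inj₂ b) (inj₁ a) e = cong inj₁ (comate-unique e)

  adj-adj : ∀ x y z → adj M x y ≡ true → adj M y z ≡ true → x ≡ z
  adj-adj x y z xy yz =
    trans (adj⇒partner y x (trans (adj-sym M y x) xy)) (sym (adj⇒partner y z yz))

alternate : {E P : BipEdges n} (Q : BipEdges n) → IsPerfectMatching E P →
  ∀ x y z → adj P x y ≡ true → adj (P ∪ₑ Q) y z ≡ true → x ≢ z → adj Q y z ≡ true
alternate {P = P} Q pmP x y z xy yz x≢z with adj-∪-split P Q y z yz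
... | inj₁ P-yz = contradiction (Matching.adj-adj pmP x y z xy P-yz) x≢z
... | inj₂ Q-yz = Q-yz

iter : ∀ {K} → ℕ → Fin (suc K)
iter zero    = fzero
iter (suc t) = next (iter t)

next-last : ∀ {K} (i : Fin (suc K)) → toℕ i ≡ K → next i ≡ fzero
next-last {K} i i≡K with toℕ i ℕ.≟ K
... | yes _   = refl
... | no  i≢K = contradiction i≡K i≢K

next-toℕ : ∀ {K} (i : Fin (suc K)) → toℕ i ≢ K → toℕ (next i) ≡ suc (toℕ i)
next-toℕ {K} i i≢K with toℕ i ℕ.≟ K
... | yes i≡K = contradiction i≡K i≢K
... | no  _   = cong suc (toℕ-lower₁ i _)

iter-toℕ : ∀ {K} t → t ℕ.< suc K → toℕ (iter {K} t) ≡ t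
iter-toℕ zero    _   = refl
iter-toℕ {K} (suc t) t<K = trans (next-toℕ (iter t) not-last) (cong suc ih)
  where
  ih : toℕ (iter {K} t) ≡ t
  ih = iter-toℕ t (ℕ.<-trans (ℕ.n<1+n t) t<K)
  not-last : toℕ (iter {K} t) ≢ K
  not-last t≡K = ℕ.<-irrefl (trans (sym ih) t≡K) (ℕ.s≤s⁻¹ t<K)

iter-wrap : ∀ K → iter {K} (suc K) ≡ fzero
iter-wrap K = next-last (iter K) (iter-toℕ K ℕ.≤-refl)

next²-≢ : ∀ {K} → 2 ℕ.≤ K → (i : Fin (suc K)) → next (next i) ≢ i
next²-≢ {K} 2≤K i loop = from-i (toℕ i ℕ.≟ K)
  where
  0≢K : 0 ≢ K
  0≢K 0≡K = ℕ.<⇒≢ (ℕ.<-trans ℕ.z<s 2≤K) 0≡K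
  1≢K : 1 ≢ K
  1≢K 1≡K = ℕ.<⇒≢ 2≤K 1≡K
  -- if i is not last: when next i is last, next² i ≡ 0 ≡ i forces
  -- K ≡ toℕ (next i) ≡ 1; otherwise next² i is i + 2 ≢ i
  from-next-i : toℕ i ≢ K → Dec (toℕ (next i) ≡ K) → ⊥
  from-next-i i≢K (yes ni≡K) =
    1≢K (trans (cong (suc ∘ toℕ) (sym (trans (sym loop) (next-last (next i) ni≡K))))
               (trans (sym (next-toℕ i i≢K)) ni≡K))
  from-next-i i≢K (no ni≢K) = ℕ.<⇒≢ (ℕ.<-trans (ℕ.n<1+n _) (ℕ.n<1+n _)) (begin
    toℕ i                ≡⟨ cong toℕ loop ⟨
    toℕ (next (next i))  ≡⟨ next-toℕ (next i) ni≢K ⟩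
    suc (toℕ (next i))   ≡⟨ cong suc (next-toℕ i i≢K) ⟩
    suc (suc (toℕ i))    ∎)
    where open ≡-Reasoning
  -- the last vertex goes to 0 and then to 1, so K ≡ 1
  from-i : Dec (toℕ i ≡ K) → ⊥
  from-i (yes i≡K) = 1≢K (begin
    1                   ≡⟨ next-toℕ fzero 0≢K ⟨
    toℕ (next fzero)    ≡⟨ cong (toℕ ∘ next) (next-last i i≡K) ⟨
    toℕ (next (next i)) ≡⟨ cong toℕ loop ⟩
    toℕ i               ≡⟨ i≡K ⟩
    K                   ∎)
    where open ≡-Reasoning
  from-i (no i≢K)  = from-next-i i≢K (toℕ (next i) ℕ.≟ K)

double : ℕ → ℕ
double zero    = zero
double (suc x) = suc (suc (double x))

double-injective : ∀ {x y} → double x ≡ double y → x ≡ y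
double-injective {zero}  {zero}  _  = refl
double-injective {suc x} {suc y} eq =
  cong suc (double-injective (ℕ.suc-injective (ℕ.suc-injective eq)))

double≡+ : ∀ x → double x ≡ x + x
double≡+ zero    = refl
double≡+ (suc x) = cong suc (trans (cong suc (double≡+ x)) (sym (ℕ.+-suc x x)))

double-< : ∀ {x n} → x ℕ.< n → suc (double x) ℕ.< n + n
double-< {x} {n} x<n = subst (ℕ._≤ n + n) (sym (double≡+ (suc x))) (ℕ.+-mono-≤ x<n x<n)

record ClosedWalk (F : BipEdges n) : Set where
  field
    walk           : ℕ → Vertex n
    step           : ∀ t → adj F (walk t) (walk (suc t)) ≡ true
    no-return      : ∀ t → walk t ≢ walk (suc (suc t))
    closed         : walk (n + n) ≡ walk 0
    even-injective : ∀ {x y} → x ℕ.< n → y ℕ.< n → walk (double x) ≡ walk (double y) → x ≡ y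
    origin         : Fin n
    starts-left    : walk 0 ≡ inj₁ origin

swap-walk : {P Q : BipEdges n} → ClosedWalk (P ∪ₑ Q) → ClosedWalk (Q ∪ₑ P)
swap-walk {P = P} {Q} W = record
  { walk = walk ; step = λ t → trans (sym (adj-∪-comm P Q (walk t) (walk (suc t)))) (step t)
  ; no-return = no-return ; closed = closed ; even-injective = even-injective
  ; origin = origin ; starts-left = starts-left }
  where open ClosedWalk W

right-neighbour : (F : BipEdges n) → ∀ b y → adj F (inj₂ b) y ≡ true → Σ (Fin n) λ a → y ≡ inj₁ a
right-neighbour F b (inj₁ a) _ = a , refl

module CycleWalk {k : ℕ} {F : BipEdges (suc k)} (3≤2n : 3 ℕ.≤ suc k + suc k)
  (v : Fin (suc k + suc k) → Vertex (suc k)) (v-inj : ∀ i j → v i ≡ v j → i ≡ j)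
  (v-step : ∀ i → adj F (v i) (v (next i)) ≡ true) where

  w : ℕ → Vertex (suc k)
  w t = v (iter t)

  w-step : ∀ t → adj F (w t) (w (suc t)) ≡ true
  w-step t = v-step (iter t)

  w-no-return : ∀ t → w t ≢ w (suc (suc t))
  w-no-return t = next²-≢ (ℕ.s≤s⁻¹ 3≤2n) (iter t) ∘ sym ∘ v-inj _ _

  w-injective : ∀ {s t} → s ℕ.< suc k + suc k → t ℕ.< suc k + suc k → w s ≡ w t → s ≡ t
  w-injective s<2n t<2n ws≡wt =
    trans (sym (iter-toℕ _ s<2n)) (trans (cong toℕ (v-inj _ _ ws≡wt)) (iter-toℕ _ t<2n))

-- A Hamilton cycle yields a closed walk: traverse it from its first vertex,
-- or from the second one if the first is a right vertex.
hamilton⇒closed-walk : {F : BipEdges n} → IsHamiltonCycle F → ClosedWalk F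
hamilton⇒closed-walk {zero} (() , _)
hamilton⇒closed-walk {suc k} {F} (3≤2n , v , v-inj , _ , _ , v-step) with v fzero in v₀
... | inj₁ a = record
  { walk = w ; step = w-step ; no-return = w-no-return
  ; closed = cong v (iter-wrap _)
  ; even-injective = λ x<n y<n eq →
      double-injective (w-injective (ℕ.<⇒≤ (double-< x<n)) (ℕ.<⇒≤ (double-< y<n)) eq)
  ; origin = a ; starts-left = v₀ }
  where open CycleWalk 3≤2n v v-inj v-step
... | inj₂ b = record
  { walk = w ∘ suc ; step = w-step ∘ suc ; no-return = w-no-return ∘ suc
  ; closed = cong (v ∘ next) (iter-wrap _)
  ; even-injective = λ x<n y<n eq →
      double-injective (ℕ.suc-injective (w-injective (double-< x<n) (double-< y<n) eq))
  ; origin = proj₁ second ; starts-left = proj₂ second }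
  where
  open CycleWalk 3≤2n v v-inj v-step
  second : Σ (Fin (suc k)) λ a → w 1 ≡ inj₁ a
  second = right-neighbour F b (w 1) (subst (λ x → adj F x (w 1) ≡ true) v₀ (w-step 0))

-- A closed walk in P ∪ Q (P, Q perfect matchings) starting along P alternates
-- between P and Q, so its left vertices are the iterates of `turn` on its origin.
module Orbit {E P Q : BipEdges n} (pmP : IsPerfectMatching E P) (pmQ : IsPerfectMatching E Q)
  (W : ClosedWalk (P ∪ₑ Q))
  (first : adj P (ClosedWalk.walk W 0) (ClosedWalk.walk W 1) ≡ true) where

  open ClosedWalk W
  private
    module MP = Matching pmP
    module MQ = Matching pmQ

  -- one P-edge followed by one Q-edge, from left vertex to left vertex
  turn : Fin n → Fin n
  turn a = MQ.comate (MP.mate a)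

  orbit : ℕ → Fin n
  orbit zero    = origin
  orbit (suc x) = turn (orbit x)

  orbit-in-walk : ∀ x → walk (double x) ≡ inj₁ (orbit x)
                      × adj P (walk (double x)) (walk (suc (double x))) ≡ true
  orbit-in-walk zero    = starts-left , first
  orbit-in-walk (suc x) = at-turn , P-edge
    where
    d : ℕ
    d = double x
    previous : walk d ≡ inj₁ (orbit x) × adj P (walk d) (walk (suc d)) ≡ true
    previous = orbit-in-walk x
    at-mate : walk (suc d) ≡ inj₂ (MP.mate (orbit x))
    at-mate = trans (MP.adj⇒partner _ _ (proj₂ previous)) (cong MP.partner (proj₁ previous))
    Q-edge : adj Q (walk (suc d)) (walk (suc (suc d))) ≡ true
    Q-edge = alternate Q pmP _ _ _ (proj₂ previous) (step (suc d)) (no-return d)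
    at-turn : walk (suc (suc d)) ≡ inj₁ (turn (orbit x))
    at-turn = trans (MQ.adj⇒partner _ _ Q-edge) (cong MQ.partner at-mate)
    P-edge : adj P (walk (suc (suc d))) (walk (suc (suc (suc d)))) ≡ true
    P-edge = alternate P pmQ _ _ _ Q-edge (ClosedWalk.step (swap-walk {P = P} {Q} W) (suc (suc d)))
               (no-return (suc d))

  orbit-closes : orbit n ≡ origin
  orbit-closes = inj₁-injective (begin
    inj₁ (orbit n)   ≡⟨ proj₁ (orbit-in-walk n) ⟨
    walk (double n)  ≡⟨ cong walk (double≡+ n) ⟩
    walk (n + n)     ≡⟨ closed ⟩
    walk 0           ≡⟨ starts-left ⟩
    inj₁ origin      ∎)
    where open ≡-Reasoning

  orbit-injective : ∀ {x y} → x ℕ.< n → y ℕ.< n → orbit x ≡ orbit y → x ≡ y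
  orbit-injective {x} {y} x<n y<n eq = even-injective x<n y<n
    (trans (proj₁ (orbit-in-walk x)) (trans (cong inj₁ eq) (sym (proj₁ (orbit-in-walk y)))))

  mate-turn : ∀ a → MQ.mate (turn a) ≡ MP.mate a
  mate-turn a = MQ.mate-comate (MP.mate a)

-- Numbering the orbit by Fin (suc k) conjugates the Q-bijection into the
-- P-bijection followed by a cycle of length suc k, so their signs differ by (-1)^k.
orbit-parity : ∀ {k} {E P Q : BipEdges (suc k)}
  (pmP : IsPerfectMatching E P) (pmQ : IsPerfectMatching E Q) (W : ClosedWalk (P ∪ₑ Q)) →
  adj P (ClosedWalk.walk W 0) (ClosedWalk.walk W 1) ≡ true →
  parity (Matching.mate pmQ) ≡ parity (Matching.mate pmP) xor odd k
orbit-parity {k} pmP pmQ W first =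
  parity-conjugate-rot (Matching.mate pmQ) (Matching.mate pmP) α
    (Matching.mate-injective pmQ) (Matching.mate-injective pmP) α-injective conjugates
  where
  open Orbit pmP pmQ W first
  α : Fin (suc k) → Fin (suc k)
  α y = orbit (toℕ y)
  α-injective : Injective _≡_ _≡_ α
  α-injective {x} {y} eq = toℕ-injective (orbit-injective (toℕ<n x) (toℕ<n y) eq)
  -- at y = 0 this uses that the orbit closes up after suc k turns
  conjugates : ∀ y → Matching.mate pmQ (α y) ≡ Matching.mate pmP (α (rot y))
  conjugates fzero    = trans (cong (Matching.mate pmQ) (sym orbit-closes))
                              (trans (mate-turn (orbit k))
                                     (cong (Matching.mate pmP ∘ orbit) (sym (toℕ-fromℕ k))))
  conjugates (fsuc y) = trans (mate-turn (orbit (toℕ y)))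
                              (cong (Matching.mate pmP ∘ orbit) (sym (toℕ-inject₁ y)))

even-flips : ∀ {k} → odd (suc k) ≡ false → ∀ {p q} → q ≡ p xor odd k → q ≢ p
even-flips {k} n-even {p} {q} q≡p+k q≡p = not-¬ {p} refl (begin
  p              ≡⟨ q≡p ⟨
  q              ≡⟨ q≡p+k ⟩
  p xor odd k    ≡⟨ cong (p xor_) odd-k ⟩
  p xor true     ≡⟨ xor-comm p true ⟩
  true xor p     ≡⟨ true-xor p ⟩
  not p          ∎)
  where
  open ≡-Reasoning
  odd-k : odd k ≡ true
  odd-k = trans (sym (not-involutive (odd k))) (cong not n-even)

walk-parity : {E P Q : BipEdges n} → odd n ≡ false →
  (pmP : IsPerfectMatching E P) (pmQ : IsPerfectMatching E Q) → ClosedWalk (P ∪ₑ Q) →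
  parity (Matching.mate pmP) ≢ parity (Matching.mate pmQ)
walk-parity {suc k} {P = P} {Q} n-even pmP pmQ W
  with adj-∪-split P Q (walk 0) (walk 1) (step 0)
  where open ClosedWalk W
... | inj₁ P-first = even-flips {k} n-even (orbit-parity {P = P} {Q} pmP pmQ W P-first) ∘ sym
... | inj₂ Q-first =
  even-flips {k} n-even (orbit-parity {P = Q} {P} pmQ pmP (swap-walk {P = P} {Q} W) Q-first)

even⇒¬odd : 2 ∣ n → odd n ≡ false
even⇒¬odd (divides q refl) = odd-double q
  where
  odd-double : ∀ q → odd (q ℕ.* 2) ≡ false
  odd-double zero    = refl
  odd-double (suc q) = cong (not ∘ not) (odd-double q)

theorem1 : (n m : ℕ) → 2 ∣ n → (E : BipEdges n) → (M : Fin m → BipEdges n) →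
    IsPerfectMatchingPartition E M → IsBipartite (GAdj M)
theorem1 _ m 2∣n _ M (perfect , _ , _) = colour , proper
  where
  colour : Fin m → Bool
  colour i = parity (Matching.mate (perfect i))
  proper : ∀ i j → GAdj M i j → colour i ≢ colour j
  proper i j (_ , hamiltonian) =
    walk-parity (even⇒¬odd 2∣n) (perfect i) (perfect j) (hamilton⇒closed-walk hamiltonian)
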